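{- Let $G=(V,E)$ be a graph whose vertex set is the disjoint union $V=I\cup T$, where $I$ is a 2-independent set of $G$ and the induced subgraph $G[T]$ is a forest. Then $G$ is $(5,1)$-total-threshold-colorable.
   Context: An edge labeling of $G$ is a map $l:E\to\{N,F\}$; an edge $e$ is near if $l(e)=N$ and far if $l(e)=F$. A threshold-coloring of $G$ with respect to $l$ is a map $c:V\to\mathbb{Z}$ for which there is an integer $t\ge 0$ (the threshold) such that for every edge $(u,v)\in E$, $|c(u)-c(v)|\le t$ if and only if $l(u,v)=N$. If $m$ and $M$ are the minimum and maximum values of $c$, any integer $r>M-m$ is a range of $c$; $c$ is then an $(r,t)$-threshold-coloring. $G$ is $(r,t)$-total-threshold-colorable if for every edge labeling $l$ of $G$ there is an $(r,t)$-threshold-coloring of $G$ with respect to $l$. A set $I\subseteq V$ is 2-independent if any two distinct vertices of $I$ are at distance at least 3 in $G$. $G[T]$ denotes the subgraph induced by $T$. -}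

module Defs where

open import Data.Nat using (ℕ; suc; _≤_; _<_)
open import Data.Fin using (Fin; zero; suc; inject₁; fromℕ)
open import Data.Bool using (Bool; true; false)
open import Data.Integer using (ℤ; _-_; ∣_∣) renaming (_<_ to _<ℤ_)
open import Data.Product using (_×_; Σ; ∃)
open import Relation.Binary.PropositionalEquality using (_≡_; _≢_)
open import Relation.Nullary using (¬_)
open import Function.Definitions using (Injective)
open import Function.Bundles using (_⇔_)

record Graph (n : ℕ) : Set where
  field
    adj   : Fin n → Fin n → Bool
    sym   : ∀ u v → adj u v ≡ adj v u
    irrefl : ∀ v → adj v v ≡ false
open Graph public

Edge : ∀ {n} → Graph n → Fin n → Fin n → Set
Edge G u v = adj G u v ≡ true

data Label : Set where
  N F : Label

-- An edge labeling: labels of unordered edges, hence symmetric.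
-- (Values on non-edges are irrelevant.)
record EdgeLabeling {n : ℕ} (G : Graph n) : Set where
  field
    lab : Fin n → Fin n → Label
    lab-sym : ∀ u v → lab u v ≡ lab v u
open EdgeLabeling public

IsThresholdColoring : ∀ {n} (G : Graph n) → EdgeLabeling G → (Fin n → ℤ) → ℕ → Set
IsThresholdColoring G l c t =
  ∀ u v → Edge G u v → ((∣ c u - c v ∣ ≤ t) ⇔ (lab l u v ≡ N))

-- r is a range of c: r > max c - min c, i.e. c u - c v < r for all u, v
HasRange : ∀ {n} → (Fin n → ℤ) → ℤ → Set
HasRange c r = ∀ u v → (c u - c v) <ℤ r

IsRTThresholdColoring : ∀ {n} (G : Graph n) → EdgeLabeling G → (Fin n → ℤ) → ℤ → ℕ → Set
IsRTThresholdColoring G l c r t = HasRange c r × IsThresholdColoring G l c t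

TotalThresholdColorable : ∀ {n} → Graph n → ℤ → ℕ → Set
TotalThresholdColorable {n} G r t =
  (l : EdgeLabeling G) → Σ (Fin n → ℤ) λ c → IsRTThresholdColoring G l c r t

-- S given as a Boolean predicate on vertices.
-- 2-independent: distinct members are at distance ≥ 3, i.e. neither adjacent
-- nor sharing a common neighbour.
TwoIndependent : ∀ {n} → Graph n → (Fin n → Bool) → Set
TwoIndependent {n} G S =
  ∀ u v → S u ≡ true → S v ≡ true → u ≢ v →
    ¬ Edge G u v × (∀ w → ¬ (Edge G u w × Edge G w v))

record CycleIn {n} (G : Graph n) (T : Fin n → Bool) : Set where
  field
    len    : ℕ
    vtx    : Fin (suc (suc (suc len))) → Fin n
    inj    : Injective _≡_ _≡_ vtx
    inT    : ∀ i → T (vtx i) ≡ true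
    step   : ∀ (i : Fin (suc (suc len))) → Edge G (vtx (inject₁ i)) (vtx (suc i))
    close  : Edge G (vtx (fromℕ (suc (suc len)))) (vtx zero)

InducedForest : ∀ {n} → Graph n → (Fin n → Bool) → Set
InducedForest G T = ¬ CycleIn G T

-- The tree vertices are 2-coloured by a sign s so that near tree edges join equal signs and
-- far ones opposite signs; since G[T] is acyclic such a signing exists (build it edge by edge,
-- and when a new edge is violated, flip the signs of everything reachable from one endpoint:
-- acyclicity guarantees the other endpoint is not reached).  The I-vertices get colour 2,
-- tree vertices of sign false get 0 or 1 and those of sign true get 3 or 4, the value further
-- from 2 being used exactly when the vertex has a far edge to I.  This is well defined because
-- 2-independence leaves every vertex at most one neighbour in I.
module Submission where

open import Defs hiding (sym)
open import Data.Bool using (Bool; true; false; not; _xor_)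
open import Data.Bool.Properties using (¬-not; xor-assoc; xor-comm; xor-same)
  renaming (_≟_ to _≟ᵇ_)
open import Data.Empty using (⊥-elim)
open import Data.Fin using (Fin; zero; suc; inject₁; fromℕ; fromℕ<; toℕ) renaming (_≟_ to _≟ᶠ_)
open import Data.Fin.Properties using (any?; injective⇒≤; toℕ-fromℕ<)
open import Data.Integer using (+_; _-_; ∣_∣)
open import Data.Integer.Properties using (∣i-j∣≡∣j-i∣; ≤-<-trans; i≤j⇒i-k≤j)
open import Data.Integer.Base using (+≤+; +<+)
open import Data.List using (List; []; _∷_; allFin; cartesianProduct)
open import Data.List.Membership.Propositional using (_∈_)
open import Data.List.Membership.Propositional.Properties using (∈-cartesianProduct⁺; ∈-allFin)
open import Data.List.Relation.Unary.Any using (here; there)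
open import Data.Nat using (ℕ; zero; suc; _≤_; _<_; _≤?_; z≤n; s≤s)
open import Data.Nat.Properties using (n<1+n)
open import Data.Product using (Σ; ∃; _×_; _,_; proj₁; proj₂)
open import Data.Product.Properties using (≡-dec)
open import Data.Sum using (_⊎_; inj₁; inj₂) renaming (swap to swap⊎)
open import Data.Unit using (⊤; tt)
open import Function.Bundles using (_⇔_; mk⇔)
open import Function.Definitions using (Injective)
open import Relation.Binary.Definitions using (Decidable; Symmetric)
open import Relation.Binary.PropositionalEquality
  using (_≡_; _≢_; refl; sym; trans; cong; cong₂; subst; module ≡-Reasoning)
open import Relation.Nullary using (¬_; Dec; yes; no; does)
open import Relation.Nullary.Decidable using (map′; _×-dec_; _⊎-dec_; dec-true; dec-false; does-⇔)

private
  variable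
    n k : ℕ

module _ {n : ℕ} where

  private
    variable
      x y z : Fin n
      R S : Fin n → Fin n → Set

  data Walk (R : Fin n → Fin n → Set) : Fin n → Fin n → ℕ → Set where
    []  : ∀ {x} → Walk R x x 0
    _∷_ : ∀ {x y z k} → R x y → Walk R y z k → Walk R x z (suc k)

  vertex : Walk R x y k → Fin (suc k) → Fin n
  vertex {x = x} _ zero = x
  vertex (_ ∷ p) (suc i) = vertex p i

  IsPath : Walk R x y k → Set
  IsPath [] = ⊤
  IsPath {x = x} (_ ∷ p) = (∀ i → vertex p i ≢ x) × IsPath p

  vertex-injective : (p : Walk R x y k) → IsPath p → Injective _≡_ _≡_ (vertex p)
  vertex-injective p _ {zero} {zero} _ = refl
  vertex-injective (_ ∷ p) (fresh , _) {zero} {suc j} eq = ⊥-elim (fresh j (sym eq))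
  vertex-injective (_ ∷ p) (fresh , _) {suc i} {zero} eq = ⊥-elim (fresh i eq)
  vertex-injective (_ ∷ p) (_ , path) {suc i} {suc j} eq = cong suc (vertex-injective p path eq)

  path-length< : (p : Walk R x y k) → IsPath p → k < n
  path-length< p path = injective⇒≤ (vertex-injective p path)

  vertex-step : (p : Walk R x y k) (i : Fin k) → R (vertex p (inject₁ i)) (vertex p (suc i))
  vertex-step (e ∷ _) zero = e
  vertex-step (_ ∷ p) (suc i) = vertex-step p i

  vertex-last : (p : Walk R x y k) → vertex p (fromℕ k) ≡ y
  vertex-last [] = refl
  vertex-last (_ ∷ p) = vertex-last p

  vertex-all : {P : Fin n → Set} → (∀ {u v} → R u v → P v) → P x →
               (p : Walk R x y k) → ∀ i → P (vertex p i)
  vertex-all _ px _ zero = px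
  vertex-all closed _ (e ∷ p) (suc i) = vertex-all closed (closed e) p i

  _∷ʳ_ : Walk R x y k → R y z → Walk R x z (suc k)
  [] ∷ʳ e = e ∷ []
  (e′ ∷ p) ∷ʳ e = e′ ∷ (p ∷ʳ e)

  map : (∀ {u v} → R u v → S u v) → Walk R x y k → Walk S x y k
  map h [] = []
  map h (e ∷ p) = h e ∷ map h p

  vertex-map : (h : ∀ {u v} → R u v → S u v) (p : Walk R x y k) →
               ∀ i → vertex (map h p) i ≡ vertex p i
  vertex-map h _ zero = refl
  vertex-map h (_ ∷ p) (suc i) = vertex-map h p i

  map-isPath : (h : ∀ {u v} → R u v → S u v) (p : Walk R x y k) → IsPath p → IsPath (map h p)
  map-isPath h [] _ = tt
  map-isPath h (_ ∷ p) (fresh , path) =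
    (λ i eq → fresh i (trans (sym (vertex-map h p i)) eq)) , map-isPath h p path

  suffix : (p : Walk R x y k) → IsPath p → (i : Fin (suc k)) →
           ∃ λ m → Σ (Walk R (vertex p i) y m) IsPath
  suffix p path zero = _ , p , path
  suffix (_ ∷ p) (_ , path) (suc i) = suffix p path i

  -- Loop erasure: if x recurs on the erased rest, restart from that occurrence.
  toPath : Walk R x y k → ∃ λ m → Σ (Walk R x y m) IsPath
  toPath [] = 0 , [] , tt
  toPath {x = x} (e ∷ p) with toPath p
  ... | m , q , path with any? (λ i → vertex q i ≟ᶠ x)
  ...   | yes (i , qi≡x) = subst (λ v → ∃ λ m → Σ (Walk _ v _ m) IsPath) qi≡x (suffix q path i)
  ...   | no x∉q = suc m , e ∷ q , (λ i eq → x∉q (i , eq)) , path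

  walk? : Decidable R → ∀ k x y → Dec (Walk R x y k)
  walk? R? zero x y = map′ (λ { refl → [] }) (λ { [] → refl }) (x ≟ᶠ y)
  walk? R? (suc k) x y =
    map′ (λ (_ , e , p) → e ∷ p) (λ { (e ∷ p) → _ , e , p })
         (any? λ z → R? x z ×-dec walk? R? k z y)

  Reachable : (Fin n → Fin n → Set) → Fin n → Fin n → Set
  Reachable R x y = ∃ (Walk R x y)

  reachable-∷ʳ : Reachable R x y → R y z → Reachable R x z
  reachable-∷ʳ (_ , p) e = _ , p ∷ʳ e

  reachable? : Decidable R → Decidable (Reachable R)
  reachable? {R = R} R? x y =
    map′ (λ (i , p) → toℕ i , p) viaPath (any? λ (i : Fin n) → walk? R? (toℕ i) x y)
    where
    viaPath : Reachable R x y → ∃ λ (i : Fin n) → Walk R x y (toℕ i)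
    viaPath (_ , p) with toPath p
    ... | _ , q , path =
      fromℕ< (path-length< q path) , subst (Walk R x y) (sym (toℕ-fromℕ< _)) q

  Acyclic : (Fin n → Fin n → Set) → Set
  Acyclic R = ∀ {a b k} (p : Walk R b a (suc (suc k))) → IsPath p → ¬ R a b

xor-cancelʳ : ∀ a b w → (a xor w) xor (b xor w) ≡ a xor b
xor-cancelʳ a b w = begin
  (a xor w) xor (b xor w)  ≡⟨ xor-assoc a w (b xor w) ⟩
  a xor (w xor (b xor w))  ≡⟨ cong (λ t → a xor (w xor t)) (xor-comm b w) ⟩
  a xor (w xor (w xor b))  ≡⟨ cong (a xor_) (sym (xor-assoc w w b)) ⟩
  a xor ((w xor w) xor b)  ≡⟨ cong (λ t → a xor (t xor b)) (xor-same w) ⟩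
  a xor b                  ∎
  where open ≡-Reasoning

xor-false-true : ∀ a b → (a xor false) xor (b xor true) ≡ not (a xor b)
xor-false-true false false = refl
xor-false-true false true = refl
xor-false-true true false = refl
xor-false-true true true = refl

module BalancedSigning {R : Fin n → Fin n → Set} (R? : Decidable R) (R-sym : Symmetric R)
               (R-irrefl : ∀ {x} → ¬ R x x) (acyclic : Acyclic R)
               (f : Fin n → Fin n → Bool) (f-sym : ∀ u v → f u v ≡ f v u) where

  Consistent : (Fin n → Bool) → Fin n → Fin n → Set
  Consistent s u v = s u xor s v ≡ f u v

  consistent-sym : ∀ s {u v} → Consistent s u v → Consistent s v u
  consistent-sym s {u} {v} c = trans (xor-comm (s v) (s u)) (trans c (f-sym u v))

  Balanced : (Fin n → Fin n → Set) → (Fin n → Bool) → Set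
  Balanced S s = ∀ {u v} → S u v → Consistent s u v

  switch-balanced : ∀ {S} s (w : Fin n → Bool) → Balanced S s →
                    (∀ {u v} → S u v → w u ≡ w v) → Balanced S (λ v → s v xor w v)
  switch-balanced s w bal w-const {u} {v} e = begin
    (s u xor w u) xor (s v xor w v)  ≡⟨ cong (λ t → (s u xor w u) xor (s v xor t)) (sym (w-const e)) ⟩
    (s u xor w u) xor (s v xor w u)  ≡⟨ xor-cancelʳ (s u) (s v) (w u) ⟩
    s u xor s v                      ≡⟨ bal e ⟩
    f u v                            ∎
    where open ≡-Reasoning

  -- The signing is built by induction over a list of all vertex pairs; Listed L is the part
  -- of R seen so far.
  Listed : List (Fin n × Fin n) → Fin n → Fin n → Set
  Listed L u v = R u v × ((u , v) ∈ L ⊎ (v , u) ∈ L)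

  listed? : ∀ L → Decidable (Listed L)
  listed? L u v = R? u v ×-dec ((u , v) ∈? L ⊎-dec (v , u) ∈? L)
    where open import Data.List.Membership.DecPropositional (≡-dec _≟ᶠ_ _≟ᶠ_) using (_∈?_)

  listed-sym : ∀ {L} → Symmetric (Listed L)
  listed-sym (r , m) = R-sym r , swap⊎ m

  extend-balanced : ∀ {L} s {a b} → Balanced (Listed L) s → (R a b → Consistent s a b) →
                    Balanced (Listed ((a , b) ∷ L)) s
  extend-balanced s bal new (r , inj₁ (here refl)) = new r
  extend-balanced s bal new (r , inj₂ (here refl)) = consistent-sym s (new (R-sym r))
  extend-balanced s bal new (r , inj₁ (there m)) = bal (r , inj₁ m)
  extend-balanced s bal new (r , inj₂ (there m)) = bal (r , inj₂ m)

  unreachable : ∀ {L} s {a b} → Balanced (Listed L) s → R a b → ¬ Consistent s a b →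
                ¬ Reachable (Listed L) b a
  unreachable s bal r bad (_ , p) with toPath p
  ... | 0 , [] , _ = R-irrefl r
  ... | 1 , e ∷ [] , _ = bad (consistent-sym s (bal e))
  ... | suc (suc _) , q , path = acyclic (map proj₁ q) (map-isPath proj₁ q path) r

  extend : ∀ {L} a b → ∃ (Balanced (Listed L)) → ∃ (Balanced (Listed ((a , b) ∷ L)))
  extend {L} a b (s , bal) with R? a b
  ... | no ¬r = s , extend-balanced s bal (λ r → ⊥-elim (¬r r))
  ... | yes r with s a xor s b ≟ᵇ f a b
  ...   | yes ok = s , extend-balanced s bal (λ _ → ok)
  ...   | no bad = s′ , extend-balanced s′ (switch-balanced s reach bal reach-const) (λ _ → switched)
    where
    reach : Fin n → Bool
    reach v = does (reachable? (listed? L) b v)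

    s′ : Fin n → Bool
    s′ v = s v xor reach v

    reach-const : ∀ {u v} → Listed L u v → reach u ≡ reach v
    reach-const {u} {v} e =
      does-⇔ (mk⇔ (λ r → reachable-∷ʳ {R = Listed L} r e)
                  (λ r → reachable-∷ʳ {R = Listed L} r (listed-sym {L} e)))
             (reachable? (listed? L) b u) (reachable? (listed? L) b v)

    switched : Consistent s′ a b
    switched = begin
      (s a xor reach a) xor (s b xor reach b)
        ≡⟨ cong₂ (λ t t′ → (s a xor t) xor (s b xor t′))
                 (dec-false (reachable? (listed? L) b a) (unreachable s bal r bad))
                 (dec-true (reachable? (listed? L) b b) (0 , [])) ⟩
      (s a xor false) xor (s b xor true)  ≡⟨ xor-false-true (s a) (s b) ⟩
      not (s a xor s b)                   ≡⟨ sym (¬-not (λ eq → bad (sym eq))) ⟩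
      f a b                               ∎
      where open ≡-Reasoning

  balanced-list : ∀ L → ∃ (Balanced (Listed L))
  balanced-list [] = (λ _ → false) , λ { (_ , inj₁ ()) ; (_ , inj₂ ()) }
  balanced-list ((a , b) ∷ L) = extend a b (balanced-list L)

  balanced : ∃ (Balanced R)
  balanced with balanced-list (cartesianProduct (allFin n) (allFin n))
  ... | s , bal = s , λ r → bal (r , inj₁ (∈-cartesianProduct⁺ (∈-allFin _) (∈-allFin _)))

module _ {n : ℕ} (G : Graph n) where

  private
    variable
      x y : Fin n

  edge-sym : Edge G x y → Edge G y x
  edge-sym {x = x} {y} e = trans (Graph.sym G y x) e

  edge-irrefl : ¬ Edge G x x
  edge-irrefl {x = x} e with trans (sym e) (Graph.irrefl G x)
  ... | ()

  edge? : Decidable (Edge G)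
  edge? u v = adj G u v ≟ᵇ true

  InducedEdge : (Fin n → Bool) → Fin n → Fin n → Set
  InducedEdge T u v = Edge G u v × T u ≡ true × T v ≡ true

  inducedEdge? : ∀ T → Decidable (InducedEdge T)
  inducedEdge? T u v = edge? u v ×-dec (T u ≟ᵇ true) ×-dec (T v ≟ᵇ true)

  inducedForest⇒acyclic : ∀ {T} → InducedForest G T → Acyclic (InducedEdge T)
  inducedForest⇒acyclic {T} forest {b = b} {k} p path (ab , _ , Tb) = forest record
    { len = k
    ; vtx = vertex p
    ; inj = vertex-injective p path
    ; inT = vertex-all (λ (_ , _ , Tv) → Tv) Tb p
    ; step = λ i → proj₁ (vertex-step p i)
    ; close = subst (λ v → Edge G v b) (sym (vertex-last p)) ab
    }

isFar : Label → Bool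
isFar N = false
isFar F = true

near? : ∀ a b → Dec (∣ + a - + b ∣ ≤ 1)
near? a b = ∣ + a - + b ∣ ≤? 1

near?-sym : ∀ a b → does (near? a b) ≡ does (near? b a)
near?-sym a b rewrite ∣i-j∣≡∣j-i∣ (+ a) (+ b) = refl

near⇔near-label : ∀ {A : Set} (a? : Dec A) lb → does a? ≡ not (isFar lb) → A ⇔ (lb ≡ N)
near⇔near-label (yes a) N _ = mk⇔ (λ _ → refl) (λ _ → a)
near⇔near-label (no ¬a) F _ = mk⇔ (λ a → ⊥-elim (¬a a)) (λ ())

treeColour : (sign farFromI : Bool) → ℕ
treeColour false false = 1
treeColour false true = 0
treeColour true false = 3
treeColour true true = 4

colour : (inI sign farFromI : Bool) → ℕ
colour true _ _ = 2
colour false s o = treeColour s o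

colour≤4 : ∀ i s o → colour i s o ≤ 4
colour≤4 true _ _ = s≤s (s≤s z≤n)
colour≤4 false false false = s≤s z≤n
colour≤4 false false true = z≤n
colour≤4 false true false = s≤s (s≤s (s≤s z≤n))
colour≤4 false true true = s≤s (s≤s (s≤s (s≤s z≤n)))

near-tree : ∀ s s′ o o′ → does (near? (treeColour s o) (treeColour s′ o′)) ≡ not (s xor s′)
near-tree false false false false = refl
near-tree false false false true = refl
near-tree false false true false = refl
near-tree false false true true = refl
near-tree false true false false = refl
near-tree false true false true = refl
near-tree false true true false = refl
near-tree false true true true = refl
near-tree true false false false = refl
near-tree true false false true = refl
near-tree true false true false = refl
near-tree true false true true = refl
near-tree true true false false = refl
near-tree true true false true = refl
near-tree true true true false = refl
near-tree true true true true = refl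

near-anchor : ∀ s o → does (near? 2 (treeColour s o)) ≡ not o
near-anchor false false = refl
near-anchor false true = refl
near-anchor true false = refl
near-anchor true true = refl

bounded⇒range : ∀ m (c : Fin n → ℕ) → (∀ v → c v ≤ m) → HasRange (λ v → + c v) (+ suc m)
bounded⇒range m c c≤m u v = ≤-<-trans (i≤j⇒i-k≤j (+ c v) (+≤+ (c≤m u))) (+<+ (n<1+n m))

module Construction (G : Graph n) (inI : Fin n → Bool) (indep : TwoIndependent G inI)
                    (forest : InducedForest G (λ v → not (inI v))) (l : EdgeLabeling G) where

  far : Fin n → Fin n → Bool
  far u v = isFar (lab l u v)

  far-sym : ∀ u v → far u v ≡ far v u
  far-sym u v = cong isFar (lab-sym l u v)

  open BalancedSigning (inducedEdge? G _) (λ (e , Tu , Tv) → edge-sym G e , Tv , Tu)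
               (λ (e , _) → edge-irrefl G e) (inducedForest⇒acyclic G forest) far far-sym

  sign : Fin n → Bool
  sign = proj₁ balanced

  FarNeighbourInI : Fin n → Set
  FarNeighbourInI v = ∃ λ w → inI w ≡ true × Edge G v w × far v w ≡ true

  farNeighbourInI? : ∀ v → Dec (FarNeighbourInI v)
  farNeighbourInI? v = any? λ w → (inI w ≟ᵇ true) ×-dec edge? G v w ×-dec (far v w ≟ᵇ true)

  farFromI : Fin n → Bool
  farFromI v = does (farNeighbourInI? v)

  farFromI-neighbour : ∀ {u v} → inI u ≡ true → Edge G u v → does (farNeighbourInI? v) ≡ far u v
  farFromI-neighbour {u} {v} Iu e with farNeighbourInI? v
  ... | yes (w , Iw , vw , far≡true) with u ≟ᶠ w
  ...   | yes refl = sym (trans (far-sym u v) far≡true)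
  ...   | no u≢w = ⊥-elim (proj₂ (indep u w Iu Iw u≢w) v (e , vw))
  farFromI-neighbour {u} {v} Iu e | no none =
    sym (¬-not λ far≡true → none (u , Iu , edge-sym G e , trans (far-sym v u) far≡true))

  c : Fin n → ℕ
  c v = colour (inI v) (sign v) (farFromI v)

  near-edge : ∀ {u v} → Edge G u v → does (near? (c u) (c v)) ≡ not (far u v)
  near-edge {u} {v} e with inI u in Iu | inI v in Iv
  ... | true | true = ⊥-elim (proj₁ (indep u v Iu Iv λ { refl → edge-irrefl G e }) e)
  ... | true | false = trans (near-anchor (sign v) (farFromI v)) (cong not (farFromI-neighbour Iu e))
  ... | false | true =
    trans (near?-sym (treeColour (sign u) (farFromI u)) 2)
      (trans (near-anchor (sign u) (farFromI u))
        (cong not (trans (farFromI-neighbour Iv (edge-sym G e)) (far-sym v u))))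
  ... | false | false =
    trans (near-tree (sign u) (sign v) (farFromI u) (farFromI v))
      (cong not (proj₂ balanced (e , cong not Iu , cong not Iv)))

mainTheorem1 : ∀ {n} (G : Graph n) (inI : Fin n → Bool) →
    TwoIndependent G inI → InducedForest G (λ v → not (inI v)) →
    TotalThresholdColorable G (+ 5) 1
mainTheorem1 G inI indep forest l =
  (λ v → + c v) ,
  bounded⇒range 4 c (λ v → colour≤4 (inI v) (sign v) (farFromI v)) ,
  λ u v e → near⇔near-label (near? (c u) (c v)) (lab l u v) (near-edge e)
  where open Construction G inI indep forest l
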